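{- Let $k$ and $a$ be positive integers and let $\varepsilon>0$. If $\mathcal{F}\subseteq 2^{[n]}$ satisfies $$|\mathcal{F}|>((k-1)a+\varepsilon)\binom{n}{\lfloor n/2\rfloor},$$ then there are at least $\frac{\varepsilon}{k}n!$ $(k,a)$-marked chains all of whose markers belong to $\mathcal{F}$.
   Context: A maximal chain in $2^{[n]}$ is a chain $\emptyset\subsetneq\{a_1\}\subsetneq\cdots\subsetneq[n]$ of $n+1$ sets (there are $n!$ of them). A $(k,a)$-marked chain is an ordered pair $(M,\{F_1,\dots,F_k\})$ where $M$ is a maximal chain in $2^{[n]}$, $F_i\in M$ for all $i\in[k]$, $F_1\supsetneq F_2\supsetneq\cdots\supsetneq F_k$, and $|F_i\setminus F_{i+1}|\ge a$ for all $i\in[k-1]$; the $F_i$ are its markers. Distinct pairs count as distinct marked chains.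
   Formalization: The parameter ε ranges over the positive rationals. -}

module Defs where

open import Data.Nat using (ℕ; suc; _≤_)
open import Data.Fin using (Fin; zero; suc; toℕ; inject₁; fromℕ)
open import Data.Fin.Subset using (Subset; ⊥; ⊤; _⊂_; _⊃_; _─_; ∣_∣)
open import Data.Vec using (Vec; lookup)
open import Data.List using (List)
open import Data.List.Membership.Propositional using () renaming (_∈_ to _∈ₗ_)
open import Data.Product using (Σ; _×_; _,_)
open import Relation.Binary.PropositionalEquality using (_≡_)
open import Function.Definitions using (Injective)

IsMaximalChain : (n : ℕ) → Vec (Subset n) (suc n) → Set
IsMaximalChain n M =
  (lookup M zero ≡ ⊥) × (lookup M (fromℕ n) ≡ ⊤) ×
  ((i : Fin n) → lookup M (inject₁ i) ⊂ lookup M (suc i))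

InChain : {n : ℕ} → Subset n → Vec (Subset n) (suc n) → Set
InChain {n} X M = Σ (Fin (suc n)) λ j → lookup M j ≡ X

-- Raw data of a marked chain: the maximal chain M and the markers F_1,...,F_k
-- (listed in order; since F_1 ⊋ ... ⊋ F_k the list is determined by the set).
MarkedChainData : (n k : ℕ) → Set
MarkedChainData n k = Vec (Subset n) (suc n) × Vec (Subset n) k

IsMarkedChainIn : (n k a : ℕ) → List (Subset n) → MarkedChainData n k → Set
IsMarkedChainIn n k a 𝓕 (M , F) =
  IsMaximalChain n M ×
  ((i : Fin k) → InChain (lookup F i) M) ×
  ((i j : Fin k) → toℕ j ≡ suc (toℕ i) →
     (lookup F i ⊃ lookup F j) × (a ≤ ∣ lookup F i ─ lookup F j ∣)) ×
  ((i : Fin k) → lookup F i ∈ₗ 𝓕)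

AtLeast : {A : Set} → ℕ → (A → Set) → Set
AtLeast {A} N P = Σ (Fin N → A) λ f → Injective _≡_ _≡_ f × ((i : Fin N) → P (f i))

{-# OPTIONS --safe #-}
-- On a maximal chain M, list the members of 𝓕 lying on M from the largest down. Starting at
-- any of them and repeatedly stepping a places further down the list gives a (k,a)-marked
-- chain with all markers in 𝓕, as long as (k-1)a more members follow; so M carries at least
-- |𝓕 ∩ M| - (k-1)a distinct such marked chains. A set X lies on exactly |X|!(n-|X|)! maximal
-- chains, and this is at least ⌊n/2⌋!⌈n/2⌉! = n!/C(n,⌊n/2⌋), so, as in the LYM inequality,
-- Σ_M |𝓕 ∩ M| ≥ |𝓕| n!/C(n,⌊n/2⌋). Hence the number N of marked chains satisfies
-- N ≥ (|𝓕|/C(n,⌊n/2⌋) - (k-1)a) n! > (p/q) n!.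
module Submission where

open import Algebra.Properties.CommutativeSemigroup using (interchange)
open import Data.Bool as Bool using ()
open import Data.Fin using (Fin; zero; suc; toℕ; fromℕ; inject₁)
open import Data.Fin.Subset
  using (Subset; ⊥; ⊤; ⁅_⁆; _⊆_; _⊂_; _⊃_; _─_; ∣_∣; inside; outside) renaming (_∈_ to _∈ˢ_)
open import Data.Fin.Subset.Properties
  using ( p⊂q⇒∣p∣<∣q∣; ∣p∣≤n; ∣⊥∣≡0; ⊥⊆; ∉⊥; x∈⁅x⁆; x∈⁅y⁆⇒x≡y
        ; s⊆s; out⊆; drop-∷-⊆; s⊂s; out⊂; out⊂in; drop-∷-⊂ )
open import Data.List as List
  using (List; []; _∷_; length; map; _++_; concatMap; filter; drop; allFin; reverse)
import Data.List.Properties as Listₚ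
open import Data.List.Membership.Propositional using (_∈_; find)
open import Data.List.Membership.Propositional.Properties using (∈-concatMap⁻; ∈-lookup; ∈-map⁻; ∈-filter⁻)
import Data.List.Membership.DecPropositional as DecMembership
open import Data.List.Relation.Binary.Permutation.Propositional using (↭-sym)
open import Data.List.Relation.Binary.Permutation.Propositional.Properties using (All-resp-↭; ↭-reverse)
open import Data.List.Relation.Unary.All as All using (All; []; _∷_)
import Data.List.Relation.Unary.All.Properties as Allₚ
open import Data.List.Relation.Unary.AllPairs as AllPairs using (AllPairs; []; _∷_)
import Data.List.Relation.Unary.AllPairs.Properties as AllPairsₚ
open import Data.List.Relation.Unary.Any using (here; there)
import Data.List.Relation.Unary.Any.Properties as Anyₚ
open import Data.List.Relation.Unary.Unique.Propositional using (Unique)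
import Data.List.Relation.Unary.Unique.Propositional.Properties as Uniqueₚ
open import Data.Maybe as Maybe using (Maybe; just; nothing)
open import Data.Nat using (ℕ; zero; suc; pred; _*_; _+_; _∸_; _≤_; _<_; _!; ⌊_/2⌋; z≤n; s≤s; _<?_; _≤?_; NonZero)
open import Data.Nat.Combinatorics using (_C_; nCk≡n!/k![n-k]!; k![n∸k]!∣n!)
open import Data.Nat.DivMod using (m/n*n≡m)
open import Data.Nat.ListAction using (sum)
open import Data.Nat.ListAction.Properties using (sum-++)
open import Data.Nat.Properties
open import Data.Nat.Solver using (module +-*-Solver)
open import Data.Product using (Σ; _×_; _,_; proj₁; proj₂)
open import Data.Vec as Vec using (Vec; []; _∷_; lookup; insertAt; removeAt; replicate; toList; here)
import Data.Vec.Properties as Vecₚ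
open import Data.Vec.Membership.Propositional.Properties using (∈-toList⁻)
import Data.Vec.Relation.Unary.Any as VecAny
import Data.Vec.Relation.Unary.Any.Properties as VecAnyₚ
open import Defs
open import Function using (_∘_; id; flip; _⇔_; mk⇔; Equivalence)
open import Function.Definitions using (Injective)
open import Relation.Binary.Definitions using (DecidableEquality)
open import Relation.Binary.PropositionalEquality
open import Relation.Nullary using (Dec; yes; no; ¬_; contradiction; _×-dec_)

open +-*-Solver using (solve; _:+_; _:*_; _:=_; con)

private variable
  A B : Set

𝟙 : ∀ {ℓ} {P : Set ℓ} → Dec P → ℕ
𝟙 (yes _) = 1
𝟙 (no _)  = 0

𝟙-cong : ∀ {ℓ ℓ′} {P : Set ℓ} {Q : Set ℓ′} → P ⇔ Q → (p? : Dec P) (q? : Dec Q) → 𝟙 p? ≡ 𝟙 q?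
𝟙-cong P⇔Q (yes p) (yes q) = refl
𝟙-cong P⇔Q (yes p) (no ¬q) = contradiction (Equivalence.to P⇔Q p) ¬q
𝟙-cong P⇔Q (no ¬p) (yes q) = contradiction (Equivalence.from P⇔Q q) ¬p
𝟙-cong P⇔Q (no ¬p) (no ¬q) = refl

𝟙-× : ∀ {ℓ ℓ′} {P : Set ℓ} {Q : Set ℓ′} (p? : Dec P) (q? : Dec Q) → 𝟙 (p? ×-dec q?) ≡ 𝟙 p? * 𝟙 q?
𝟙-× (yes _) (yes _) = refl
𝟙-× (yes _) (no _)  = refl
𝟙-× (no _)  _       = refl

𝟙-yes : ∀ {ℓ} {P : Set ℓ} → P → (p? : Dec P) → 𝟙 p? ≡ 1
𝟙-yes p (yes _) = refl
𝟙-yes p (no ¬p) = contradiction p ¬p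

𝟙-no : ∀ {ℓ} {P : Set ℓ} → ¬ P → (p? : Dec P) → 𝟙 p? ≡ 0
𝟙-no ¬p (yes p) = contradiction p ¬p
𝟙-no ¬p (no _)  = refl

∑ : List A → (A → ℕ) → ℕ
∑ xs f = sum (map f xs)

syntax ∑ xs (λ x → e) = ∑[ x ← xs ] e

∑-++ : ∀ (xs ys : List A) f → ∑ (xs ++ ys) f ≡ ∑ xs f + ∑ ys f
∑-++ xs ys f = trans (cong sum (Listₚ.map-++ f xs ys)) (sum-++ (map f xs) (map f ys))

∑-concatMap : ∀ (g : A → List B) xs f → ∑ (concatMap g xs) f ≡ ∑[ x ← xs ] ∑ (g x) f
∑-concatMap g []       f = refl
∑-concatMap g (x ∷ xs) f = trans (∑-++ (g x) (concatMap g xs) f) (cong (∑ (g x) f +_) (∑-concatMap g xs f))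

∑-map : ∀ (h : A → B) xs f → ∑ (map h xs) f ≡ ∑ xs (f ∘ h)
∑-map h xs f = cong sum (sym (Listₚ.map-∘ xs))

∑-cong : ∀ (xs : List A) {f g} → (∀ x → f x ≡ g x) → ∑ xs f ≡ ∑ xs g
∑-cong xs f≗g = cong sum (Listₚ.map-cong f≗g xs)

∑-mono : ∀ (xs : List A) {f g} → (∀ x → f x ≤ g x) → ∑ xs f ≤ ∑ xs g
∑-mono []       f≤g = z≤n
∑-mono (x ∷ xs) f≤g = +-mono-≤ (f≤g x) (∑-mono xs f≤g)

∑-const : ∀ (xs : List A) c → ∑[ _ ← xs ] c ≡ length xs * c
∑-const []       c = refl
∑-const (x ∷ xs) c = cong (c +_) (∑-const xs c)

∑-*ˡ : ∀ (xs : List A) c f → ∑[ x ← xs ] (c * f x) ≡ c * ∑ xs f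
∑-*ˡ []       c f = sym (*-zeroʳ c)
∑-*ˡ (x ∷ xs) c f = trans (cong (c * f x +_) (∑-*ˡ xs c f)) (sym (*-distribˡ-+ c (f x) _))

∑-*ʳ : ∀ (xs : List A) c f → ∑[ x ← xs ] (f x * c) ≡ ∑ xs f * c
∑-*ʳ xs c f = trans (∑-cong xs (λ x → *-comm (f x) c)) (trans (∑-*ˡ xs c f) (*-comm c (∑ xs f)))

∑-+ : ∀ (xs : List A) f g → ∑[ x ← xs ] (f x + g x) ≡ ∑ xs f + ∑ xs g
∑-+ []       f g = refl
∑-+ (x ∷ xs) f g = trans (cong (f x + g x +_) (∑-+ xs f g)) (interchange +-commutativeSemigroup (f x) (g x) _ _)

∑-swap : ∀ (xs : List A) (ys : List B) (f : A → B → ℕ) → ∑[ x ← xs ] ∑[ y ← ys ] f x y ≡ ∑[ y ← ys ] ∑[ x ← xs ] f x y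
∑-swap []       ys f = sym (trans (∑-const ys 0) (*-zeroʳ (length ys)))
∑-swap (x ∷ xs) ys f = trans (cong (∑[ y ← ys ] f x y +_) (∑-swap xs ys f)) (sym (∑-+ ys (f x) (λ y → ∑[ x′ ← xs ] f x′ y)))

length-concatMap : ∀ (g : A → List B) xs → length (concatMap g xs) ≡ ∑ xs (length ∘ g)
length-concatMap g []       = refl
length-concatMap g (x ∷ xs) = trans (Listₚ.length-++ (g x)) (cong (length (g x) +_) (length-concatMap g xs))

length-filter : ∀ {P : A → Set} (P? : ∀ x → Dec (P x)) xs → length (filter P? xs) ≡ ∑[ x ← xs ] 𝟙 (P? x)
length-filter P? []       = refl
length-filter P? (x ∷ xs) with P? x
... | yes _ = cong suc (length-filter P? xs)
... | no  _ = length-filter P? xs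

length-allFin : ∀ n → length (allFin n) ≡ n
length-allFin n = Listₚ.length-tabulate {n = n} id

∑-allFin-suc : ∀ {n} (f : Fin (suc n) → ℕ) → ∑ (allFin (suc n)) f ≡ f zero + ∑[ i ← allFin n ] f (suc i)
∑-allFin-suc {n} f = cong (λ xs → f zero + sum xs) (trans (Listₚ.map-tabulate suc f) (sym (Listₚ.map-tabulate id (f ∘ suc))))

module _ (_≟_ : DecidableEquality A) where
  open DecMembership _≟_ using (_∈?_)

  ∑𝟙≟-absent : ∀ {y} xs → All (y ≢_) xs → ∑[ x ← xs ] 𝟙 (y ≟ x) ≡ 0
  ∑𝟙≟-absent []       []           = refl
  ∑𝟙≟-absent (x ∷ xs) (y≢x ∷ y∉xs) = cong₂ _+_ (𝟙-no y≢x (_ ≟ x)) (∑𝟙≟-absent xs y∉xs)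

  ∑𝟙≟-unique : ∀ y {xs} → Unique xs → ∑[ x ← xs ] 𝟙 (y ≟ x) ≡ 𝟙 (y ∈? xs)
  ∑𝟙≟-unique y {[]}     []             = refl
  ∑𝟙≟-unique y {x ∷ xs} (x∉xs ∷ uniq) = split (y ≟ x)
    where
    split : (y≟x : Dec (y ≡ x)) → 𝟙 y≟x + ∑[ x′ ← xs ] 𝟙 (y ≟ x′) ≡ 𝟙 (y ∈? x ∷ xs)
    split (yes refl) = trans (cong suc (∑𝟙≟-absent xs x∉xs)) (sym (𝟙-yes (here refl) (y ∈? x ∷ xs)))
    split (no y≢x)   = trans (∑𝟙≟-unique y uniq) (𝟙-cong (mk⇔ there drop-head) (y ∈? xs) (y ∈? x ∷ xs))
      where
      drop-head : y ∈ x ∷ xs → y ∈ xs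
      drop-head (here y≡x)  = contradiction y≡x y≢x
      drop-head (there y∈xs) = y∈xs

concatMap-unique : ∀ {g : A → List B} {xs} → Unique xs → (∀ {x} → x ∈ xs → Unique (g x)) →
                   (∀ {x x′ b} → x ∈ xs → x′ ∈ xs → b ∈ g x → b ∈ g x′ → x ≡ x′) →
                   Unique (concatMap g xs)
concatMap-unique {xs = []}     []            _      _       = []
concatMap-unique {xs = x ∷ xs} (x∉xs ∷ uniq) unique disjoint =
  Uniqueₚ.++⁺ (unique (here refl)) (concatMap-unique uniq (unique ∘ there) (λ p q → disjoint (there p) (there q))) apart
  where
  apart : ∀ {b} → ¬ (b ∈ _ × b ∈ concatMap _ xs)
  apart (b∈gx , b∈rest) with find (∈-concatMap⁻ _ {xs = xs} b∈rest)
  ... | x′ , x′∈xs , b∈gx′ = All.lookup x∉xs x′∈xs (disjoint (here refl) (there x′∈xs) b∈gx b∈gx′)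

lookup-injective : ∀ {xs : List A} → Unique xs → Injective _≡_ _≡_ (List.lookup xs)
lookup-injective (x∉xs ∷ uniq) {zero}  {zero}  _ = refl
lookup-injective (x∉xs ∷ uniq) {zero}  {suc j} e = contradiction e (All.lookup x∉xs (∈-lookup j))
lookup-injective (x∉xs ∷ uniq) {suc i} {zero}  e = contradiction (sym e) (All.lookup x∉xs (∈-lookup i))
lookup-injective (x∉xs ∷ uniq) {suc i} {suc j} e = cong suc (lookup-injective uniq e)

atLeast-length : ∀ {P : A → Set} {xs} → Unique xs → All P xs → AtLeast (length xs) P
atLeast-length {xs = xs} uniq all = List.lookup xs , lookup-injective uniq , λ i → All.lookup all (∈-lookup i)

All-concatMap⁺ : ∀ {P : B → Set} {g : A → List B} {xs} → All (λ x → All P (g x)) xs → All P (concatMap g xs)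
All-concatMap⁺ = Allₚ.concat⁺ ∘ Allₚ.map⁺

AllPairs-reverse⁺ : ∀ {R : A → A → Set} {xs} → AllPairs R xs → AllPairs (flip R) (reverse xs)
AllPairs-reverse⁺ {xs = []}     []             = []
AllPairs-reverse⁺ {xs = x ∷ xs} (Rx[xs] ∷ pairs) = subst (AllPairs _) (sym (Listₚ.unfold-reverse x xs))
  (AllPairsₚ.++⁺ (AllPairs-reverse⁺ pairs) ([] ∷ []) (All.map (_∷ []) (All-resp-↭ (↭-sym (↭-reverse xs)) Rx[xs])))

∈-drop⁻ : ∀ d {xs : List A} {y} → y ∈ drop d xs → y ∈ xs
∈-drop⁻ zero             y∈xs = y∈xs
∈-drop⁻ (suc d) {_ ∷ xs} y∈xs = there (∈-drop⁻ d y∈xs)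

insertAt≡⇔ : ∀ {n} (xs : Vec A n) (ys : Vec A (suc n)) i v → insertAt xs i v ≡ ys ⇔ (lookup ys i ≡ v × xs ≡ removeAt ys i)
insertAt≡⇔ xs ys i v = mk⇔ (λ { refl → Vecₚ.insertAt-lookup xs i v , sym (Vecₚ.removeAt-insertAt xs i v) })
                           (λ { (refl , refl) → Vecₚ.insertAt-removeAt ys i })

insertAt-injective : ∀ {n} i v {xs ys : Vec A n} → insertAt xs i v ≡ insertAt ys i v → xs ≡ ys
insertAt-injective i v {xs} {ys} eq = begin
  xs                           ≡⟨ Vecₚ.removeAt-insertAt xs i v ⟨
  removeAt (insertAt xs i v) i ≡⟨ cong (λ zs → removeAt zs i) eq ⟩
  removeAt (insertAt ys i v) i ≡⟨ Vecₚ.removeAt-insertAt ys i v ⟩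
  ys                           ∎
  where open ≡-Reasoning

insertAt-replicate : ∀ {n} (x : A) i → insertAt (replicate n x) i x ≡ replicate (suc n) x
insertAt-replicate {n = n}     x zero    = refl
insertAt-replicate {n = suc n} x (suc i) = cong (x ∷_) (insertAt-replicate x i)

map-injective : ∀ {f : A → B} → Injective _≡_ _≡_ f → ∀ {n} → Injective _≡_ _≡_ (Vec.map {n = n} f)
map-injective f-inj {x = []}    {[]}    _  = refl
map-injective f-inj {x = x ∷ xs} {y ∷ ys} eq =
  cong₂ _∷_ (f-inj (Vecₚ.∷-injectiveˡ eq)) (map-injective f-inj (Vecₚ.∷-injectiveʳ eq))

_≟ˢ_ : ∀ {n} → DecidableEquality (Subset n)
_≟ˢ_ = Vecₚ.≡-dec Bool._≟_

∣insertAt∣ : ∀ {n} (p : Subset n) i → ∣ insertAt p i inside ∣ ≡ suc ∣ p ∣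
∣insertAt∣ p             zero    = refl
∣insertAt∣ (outside ∷ p) (suc i) = ∣insertAt∣ p i
∣insertAt∣ (inside ∷ p)  (suc i) = cong suc (∣insertAt∣ p i)

∣removeAt∣ : ∀ {n} (p : Subset (suc n)) i → lookup p i ≡ inside → suc ∣ removeAt p i ∣ ≡ ∣ p ∣
∣removeAt∣ p i i∈p = begin
  suc ∣ removeAt p i ∣                       ≡⟨ ∣insertAt∣ (removeAt p i) i ⟨
  ∣ insertAt (removeAt p i) i inside ∣       ≡⟨ cong (λ b → ∣ insertAt (removeAt p i) i b ∣) i∈p ⟨
  ∣ insertAt (removeAt p i) i (lookup p i) ∣ ≡⟨ cong ∣_∣ (Vecₚ.insertAt-removeAt p i) ⟩
  ∣ p ∣                                      ∎
  where open ≡-Reasoning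

insertAt-⊆ : ∀ {n} {p q : Subset n} i b → p ⊆ q → insertAt p i b ⊆ insertAt q i b
insertAt-⊆                                 zero    b p⊆q = s⊆s p⊆q
insertAt-⊆ {p = outside ∷ p} {_ ∷ q}       (suc i) b p⊆q = out⊆ (insertAt-⊆ i b (drop-∷-⊆ p⊆q))
insertAt-⊆ {p = inside ∷ p}  {inside ∷ q}  (suc i) b p⊆q = s⊆s (insertAt-⊆ i b (drop-∷-⊆ p⊆q))
insertAt-⊆ {p = inside ∷ p}  {outside ∷ q} (suc i) b p⊆q with () ← p⊆q here

insertAt-⊂ : ∀ {n} {p q : Subset n} i b → p ⊂ q → insertAt p i b ⊂ insertAt q i b
insertAt-⊂                                 zero    b p⊂q = s⊂s p⊂q
insertAt-⊂ {p = outside ∷ p} {outside ∷ q} (suc i) b p⊂q = out⊂ (insertAt-⊂ i b (drop-∷-⊂ p⊂q))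
insertAt-⊂ {p = outside ∷ p} {inside ∷ q}  (suc i) b p⊂q = out⊂in (insertAt-⊆ i b (drop-∷-⊆ (proj₁ p⊂q)))
insertAt-⊂ {p = inside ∷ p}  {inside ∷ q}  (suc i) b p⊂q = s⊂s (insertAt-⊂ i b (drop-∷-⊂ p⊂q))
insertAt-⊂ {p = inside ∷ p}  {outside ∷ q} (suc i) b p⊂q with () ← proj₁ p⊂q here

⊥⊂insertAt : ∀ {n} (p : Subset n) i → ⊥ ⊂ insertAt p i inside
⊥⊂insertAt p i = ⊥⊆ , i , Vecₚ.lookup⇒[]= i _ (Vecₚ.insertAt-lookup p i inside) , ∉⊥

insertAt-⊥ : ∀ {n} i → insertAt (⊥ {n}) i inside ≡ ⁅ i ⁆
insertAt-⊥ zero    = refl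
insertAt-⊥ {suc n} (suc i) = cong (outside ∷_) (insertAt-⊥ i)

∣p∣≡0⇒p≡⊥ : ∀ {n} {p : Subset n} → ∣ p ∣ ≡ 0 → p ≡ ⊥
∣p∣≡0⇒p≡⊥ {p = []}          _     = refl
∣p∣≡0⇒p≡⊥ {p = outside ∷ p} ∣p∣≡0 = cong (outside ∷_) (∣p∣≡0⇒p≡⊥ ∣p∣≡0)

∣p─q∣+∣q∣≡∣p∣ : ∀ {n} {p q : Subset n} → q ⊆ p → ∣ p ─ q ∣ + ∣ q ∣ ≡ ∣ p ∣
∣p─q∣+∣q∣≡∣p∣ {p = []}          {[]}          _   = refl
∣p─q∣+∣q∣≡∣p∣ {p = outside ∷ p} {outside ∷ q} q⊆p = ∣p─q∣+∣q∣≡∣p∣ (drop-∷-⊆ q⊆p)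
∣p─q∣+∣q∣≡∣p∣ {p = inside ∷ p}  {outside ∷ q} q⊆p = cong suc (∣p─q∣+∣q∣≡∣p∣ (drop-∷-⊆ q⊆p))
∣p─q∣+∣q∣≡∣p∣ {p = inside ∷ p}  {inside ∷ q}  q⊆p = trans (+-suc _ _) (cong suc (∣p─q∣+∣q∣≡∣p∣ (drop-∷-⊆ q⊆p)))
∣p─q∣+∣q∣≡∣p∣ {p = outside ∷ p} {inside ∷ q}  q⊆p with () ← q⊆p here

∣p∣≡∑-lookup : ∀ {n} (p : Subset n) → ∣ p ∣ ≡ ∑[ i ← allFin n ] 𝟙 (lookup p i Bool.≟ inside)
∣p∣≡∑-lookup []            = refl
∣p∣≡∑-lookup (outside ∷ p) = trans (∣p∣≡∑-lookup p) (sym (∑-allFin-suc (λ i → 𝟙 (lookup (outside ∷ p) i Bool.≟ inside))))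
∣p∣≡∑-lookup (inside ∷ p)  = trans (cong suc (∣p∣≡∑-lookup p)) (sym (∑-allFin-suc (λ i → 𝟙 (lookup (inside ∷ p) i Bool.≟ inside))))

midFactorials : ℕ → ℕ
midFactorials n = ⌊ n /2⌋ ! * (n ∸ ⌊ n /2⌋) !

nCk*k![n∸k]!≡n! : ∀ {n k} → k ≤ n → (n C k) * (k ! * (n ∸ k) !) ≡ n !
nCk*k![n∸k]!≡n! {n} {k} k≤n = trans (cong (_* (k ! * (n ∸ k) !)) (nCk≡n!/k![n-k]! k≤n)) (m/n*n≡m (k![n∸k]!∣n! k≤n))
  where instance
    _ : NonZero (k ! * (n ∸ k) !)
    _ = k !* (n ∸ k) !≢0

[1+a]!*b!≤a!*[1+b]! : ∀ {a b} → a ≤ b → suc a ! * b ! ≤ a ! * suc b !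
[1+a]!*b!≤a!*[1+b]! {a} {b} a≤b = begin
  suc a ! * b !         ≡⟨ solve 3 (λ x fa fb → (x :* fa) :* fb := fa :* (x :* fb)) refl (suc a) (a !) (b !) ⟩
  a ! * (suc a * b !)   ≤⟨ *-monoʳ-≤ (a !) (*-monoˡ-≤ (b !) (s≤s a≤b)) ⟩
  a ! * suc b !         ∎
  where open ≤-Reasoning

midFactorials-≡ : ∀ a d → ⌊ a + (a + d) /2⌋ ≡ a → midFactorials (a + (a + d)) ≡ a ! * (a + d) !
midFactorials-≡ a d half = trans (cong (λ m → m ! * (a + (a + d) ∸ m) !) half) (cong (λ m → a ! * m !) (m+n∸m≡n a (a + d)))

midFactorials-≤ : ∀ a d → midFactorials (a + (a + d)) ≤ a ! * (a + d) !
midFactorials-≤ a zero          = ≤-reflexive (midFactorials-≡ a 0 (trans (cong (λ m → ⌊ a + m /2⌋) (+-identityʳ a)) (sym (n≡⌊n+n/2⌋ a))))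
midFactorials-≤ a (suc zero)    = ≤-reflexive (midFactorials-≡ a 1 (trans (cong ⌊_/2⌋ (trans (cong (a +_) (+-comm a 1)) (+-suc a a))) (sym (n≡⌈n+n/2⌉ a))))
midFactorials-≤ a (suc (suc d)) = begin
  midFactorials (a + (a + suc (suc d)))
    ≡⟨ cong midFactorials (solve 2 (λ x y → x :+ (x :+ (con 2 :+ y)) := (con 1 :+ x) :+ ((con 1 :+ x) :+ y)) refl a d) ⟩
  midFactorials (suc a + (suc a + d))    ≤⟨ midFactorials-≤ (suc a) d ⟩
  suc a ! * (suc a + d) !                ≤⟨ [1+a]!*b!≤a!*[1+b]! (m≤n⇒m≤1+n (m≤m+n a d)) ⟩
  a ! * suc (suc a + d) !                ≡⟨ cong (λ m → a ! * m !) (sym (trans (+-suc a (suc d)) (cong suc (+-suc a d)))) ⟩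
  a ! * (a + suc (suc d)) !              ∎
  where open ≤-Reasoning

midFactorials-minimal : ∀ {n s} → s ≤ n → midFactorials n ≤ s ! * (n ∸ s) !
midFactorials-minimal {n} {s} s≤n with s ≤? n ∸ s
... | yes s≤n∸s = subst₂ _≤_ (cong midFactorials n≡) (cong (λ m → s ! * m !) n∸s≡) (midFactorials-≤ s (n ∸ s ∸ s))
  where
  n∸s≡ : s + (n ∸ s ∸ s) ≡ n ∸ s
  n∸s≡ = m+[n∸m]≡n s≤n∸s
  n≡ : s + (s + (n ∸ s ∸ s)) ≡ n
  n≡ = trans (cong (s +_) n∸s≡) (m+[n∸m]≡n s≤n)
... | no  s≰n∸s = subst₂ _≤_ (cong midFactorials n≡) (trans (cong (λ m → (n ∸ s) ! * m !) s≡) (*-comm ((n ∸ s) !) (s !)))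
                    (midFactorials-≤ (n ∸ s) (s ∸ (n ∸ s)))
  where
  s≡ : n ∸ s + (s ∸ (n ∸ s)) ≡ s
  s≡ = m+[n∸m]≡n (<⇒≤ (≰⇒> s≰n∸s))
  n≡ : n ∸ s + (n ∸ s + (s ∸ (n ∸ s))) ≡ n
  n≡ = trans (cong (n ∸ s +_) s≡) (m∸n+n≡m s≤n)

-- Greedy choice of markers along a list: each marker lies suc d places below the previous one.
module Markers {A : Set} {_≻_ : A → A → Set} (σ : A → ℕ) (σ-mono : ∀ {x y} → x ≻ y → σ y < σ x) (d : ℕ) where

  Descending : List A → Set
  Descending = AllPairs _≻_

  Spaced : ∀ {k} → Vec A k → Set
  Spaced v = ∀ i j → toℕ j ≡ suc (toℕ i) → lookup v i ≻ lookup v j × suc d + σ (lookup v j) ≤ σ (lookup v i)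

  firstMarkers : (k : ℕ) → List A → Maybe (Vec A k)
  firstMarkers zero    _        = just []
  firstMarkers (suc k) []       = nothing
  firstMarkers (suc k) (x ∷ xs) = Maybe.map (x ∷_) (firstMarkers k (drop d xs))

  markers : (k : ℕ) → List A → List (Vec A k)
  markers k []       = []
  markers k (x ∷ xs) with firstMarkers k (x ∷ xs)
  ... | just v  = v ∷ markers k xs
  ... | nothing = markers k xs

  MarkersIn : ∀ {k} → List A → Vec A k → Set
  MarkersIn l v = (∀ i → lookup v i ∈ l) × Spaced v

  drop-spacing : ∀ e {x xs y ys} → Descending (x ∷ xs) → drop e xs ≡ y ∷ ys → suc e + σ y ≤ σ x
  drop-spacing zero    {xs = _ ∷ _}  ((x≻y ∷ _) ∷ _)        refl = σ-mono x≻y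
  drop-spacing (suc e) {xs = _ ∷ xs} ((x≻x′ ∷ _) ∷ desc) eq   = ≤-trans (s≤s (drop-spacing e desc eq)) (σ-mono x≻x′)

  firstMarkers-head : ∀ k l {y} {w : Vec A k} → firstMarkers (suc k) l ≡ just (y ∷ w) → Σ (List A) λ ys → l ≡ y ∷ ys
  firstMarkers-head k (x ∷ xs) eq with firstMarkers k (drop d xs)
  firstMarkers-head k (x ∷ xs) refl | just w = xs , refl

  firstMarkers-valid : ∀ k l {v} → Descending l → firstMarkers k l ≡ just v → MarkersIn l v
  firstMarkers-valid zero    l        desc refl = (λ ()) , (λ ())
  firstMarkers-valid (suc k) (x ∷ xs) desc@(x≻xs ∷ desc′) eq with firstMarkers k (drop d xs) in eq′
  ... | just w with refl ← eq = members , spaced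
    where
    rest : MarkersIn (drop d xs) w
    rest = firstMarkers-valid k (drop d xs) (AllPairsₚ.drop⁺ d desc′) eq′
    members : ∀ i → lookup (x ∷ w) i ∈ x ∷ xs
    members zero    = here refl
    members (suc i) = there (∈-drop⁻ d (proj₁ rest i))
    next : ∀ {k′} (w′ : Vec A (suc k′)) → firstMarkers (suc k′) (drop d xs) ≡ just w′ →
           x ≻ lookup w′ zero × suc d + σ (lookup w′ zero) ≤ σ x
    next {k′} (y ∷ _) eq″ with firstMarkers-head k′ (drop d xs) eq″
    ... | ys , drop≡ = All.lookup x≻xs (∈-drop⁻ d (subst (y ∈_) (sym drop≡) (here refl))) , drop-spacing d desc drop≡
    spaced : Spaced (x ∷ w)
    spaced zero    (suc zero)    _  = next w eq′
    spaced (suc i) (suc j)       eq = proj₂ rest i j (suc-injective eq)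
    spaced zero    zero          ()
    spaced zero    (suc (suc _)) ()
    spaced (suc _) zero          ()

  firstMarkers-just : ∀ k l → k * suc d < length l → Σ (Vec A (suc k)) λ v → firstMarkers (suc k) l ≡ just v
  firstMarkers-just zero    (x ∷ xs) _ = x ∷ [] , refl
  firstMarkers-just (suc k) (x ∷ xs) (s≤s long) with firstMarkers-just k (drop d xs) long′
    where
    long′ : k * suc d < length (drop d xs)
    long′ = subst (k * suc d <_) (sym (Listₚ.length-drop d xs))
              (m+n≤o⇒m≤o∸n (suc (k * suc d)) (subst (_≤ length xs) (cong suc (+-comm d (k * suc d))) long))
  ... | w , eq = x ∷ w , cong (Maybe.map (x ∷_)) eq

  length-markers : ∀ k l → length l ≤ length (markers (suc k) l) + k * suc d
  length-markers k []       = z≤n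
  length-markers k (x ∷ xs) with k * suc d <? length (x ∷ xs)
  ... | no short = ≤-trans (≮⇒≥ short) (m≤n+m _ _)
  ... | yes long with firstMarkers (suc k) (x ∷ xs) | firstMarkers-just k (x ∷ xs) long
  ...   | just _  | _ = s≤s (length-markers k xs)

  MarkersIn-there : ∀ {k x xs} {v : Vec A k} → MarkersIn xs v → MarkersIn (x ∷ xs) v
  MarkersIn-there (members , spaced) = there ∘ members , spaced

  markers-valid : ∀ k l → Descending l → All (MarkersIn l) (markers k l)
  markers-valid k []       _                = []
  markers-valid k (x ∷ xs) desc@(_ ∷ desc′) with firstMarkers k (x ∷ xs) in eq
  ... | just v  = firstMarkers-valid k (x ∷ xs) desc eq ∷ All.map (λ {v} → MarkersIn-there {v = v}) (markers-valid k xs desc′)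
  ... | nothing = All.map (λ {v} → MarkersIn-there {v = v}) (markers-valid k xs desc′)

  markers-unique : ∀ k l → Descending l → Unique (markers (suc k) l)
  markers-unique k []       _                  = []
  markers-unique k (x ∷ xs) (x≻xs ∷ desc′) with firstMarkers (suc k) (x ∷ xs) in eq
  ... | nothing = markers-unique k xs desc′
  ... | just (y ∷ w) = All.map (λ {u} → fresh {u}) (markers-valid (suc k) xs desc′) ∷ markers-unique k xs desc′
    where
    fresh : ∀ {u} → MarkersIn xs u → y ∷ w ≢ u
    fresh (members , _) refl with firstMarkers-head k (x ∷ xs) eq
    ... | _ , refl = <-irrefl refl (σ-mono (All.lookup x≻xs (members zero)))

Chain : ℕ → Set
Chain n = Vec (Subset n) (suc n)

∈-toList⇒InChain : ∀ {n} {X} {Z : Chain n} → X ∈ toList Z → InChain X Z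
∈-toList⇒InChain X∈Z = VecAny.index (∈-toList⁻ X∈Z) , sym (VecAnyₚ.lookup-index (∈-toList⁻ X∈Z))

-- The maximal chain of 2^[n+1] that first adds the point e and then follows Z on the other
-- n points (relabelled by insertAt); every maximal chain arises exactly once in this way.
extend : ∀ {n} → Chain n → Fin (suc n) → Chain (suc n)
extend Z e = ⊥ ∷ Vec.map (λ Y → insertAt Y e inside) Z

chains : ∀ n → List (Chain n)
chains zero    = (⊥ ∷ []) ∷ []
chains (suc n) = concatMap (λ Z → map (extend Z) (allFin (suc n))) (chains n)

chains-induction : (P : ∀ {n} → Chain n → Set) → P (⊥ ∷ []) → (∀ {n} {Z : Chain n} e → P Z → P (extend Z e)) →
                   ∀ n → All P (chains n)
chains-induction P base step zero    = base ∷ []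
chains-induction P base step (suc n) =
  All-concatMap⁺ (All.map (λ {Z} PZ → Allₚ.map⁺ {f = extend Z} (All.universal (λ e → step e PZ) (allFin (suc n))))
                          (chains-induction P base step n))

∑-chains-suc : ∀ n (f : Chain (suc n) → ℕ) → ∑ (chains (suc n)) f ≡ ∑[ Z ← chains n ] ∑[ e ← allFin (suc n) ] f (extend Z e)
∑-chains-suc n f = trans (∑-concatMap _ (chains n) f) (∑-cong (chains n) (λ Z → ∑-map (extend Z) (allFin (suc n)) f))

length-chains : ∀ n → length (chains n) ≡ n !
length-chains zero    = refl
length-chains (suc n) = begin
  length (chains (suc n))                                    ≡⟨ length-concatMap _ (chains n) ⟩
  ∑[ Z ← chains n ] length (map (extend Z) (allFin (suc n))) ≡⟨ ∑-cong (chains n) length-extensions ⟩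
  ∑[ Z ← chains n ] suc n                                    ≡⟨ ∑-const (chains n) (suc n) ⟩
  length (chains n) * suc n                                  ≡⟨ cong (_* suc n) (length-chains n) ⟩
  n ! * suc n                                                ≡⟨ *-comm (n !) (suc n) ⟩
  suc n !                                                    ∎
  where
  open ≡-Reasoning
  length-extensions : ∀ Z → length (map (extend Z) (allFin (suc n))) ≡ suc n
  length-extensions Z = trans (Listₚ.length-map (extend Z) (allFin (suc n))) (length-allFin (suc n))

extend-maximal : ∀ {n} {Z : Chain n} e → IsMaximalChain n Z → IsMaximalChain (suc n) (extend Z e)
extend-maximal {n} {Z} e (_ , top , steps) = refl , top′ , steps′
  where
  f : Subset n → Subset (suc n)
  f Y = insertAt Y e inside
  top′ : lookup (Vec.map f Z) (fromℕ n) ≡ ⊤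
  top′ = trans (Vecₚ.lookup-map (fromℕ n) f Z) (trans (cong f top) (insertAt-replicate inside e))
  steps′ : ∀ i → lookup (extend Z e) (inject₁ i) ⊂ lookup (extend Z e) (suc i)
  steps′ zero    = subst (⊥ ⊂_) (sym (Vecₚ.lookup-map zero f Z)) (⊥⊂insertAt (lookup Z zero) e)
  steps′ (suc i) = subst₂ _⊂_ (sym (Vecₚ.lookup-map (inject₁ i) f Z)) (sym (Vecₚ.lookup-map (suc i) f Z)) (insertAt-⊂ e inside (steps i))

extend-strict : ∀ {n} {Z : Chain n} e → AllPairs _⊂_ (toList Z) → AllPairs _⊂_ (toList (extend Z e))
extend-strict {Z = Z} e strict = subst (λ Ys → AllPairs _⊂_ (⊥ ∷ Ys)) (sym (Vecₚ.toList-map _ Z))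
  (Allₚ.map⁺ (All.universal (λ Y → ⊥⊂insertAt Y e) _) ∷ AllPairsₚ.map⁺ (AllPairs.map (insertAt-⊂ e inside) strict))

chains-maximal : ∀ n → All (IsMaximalChain n) (chains n)
chains-maximal = chains-induction (λ {n} → IsMaximalChain n) (refl , refl , λ ()) extend-maximal

chains-strict : ∀ n → All (λ Z → AllPairs _⊂_ (toList Z)) (chains n)
chains-strict = chains-induction (λ Z → AllPairs _⊂_ (toList Z)) ([] ∷ []) extend-strict

extend-injective : ∀ {n} {Z Z′ : Chain n} {e e′} → lookup Z zero ≡ ⊥ → lookup Z′ zero ≡ ⊥ →
                   extend Z e ≡ extend Z′ e′ → e ≡ e′ × Z ≡ Z′
extend-injective {Z = Z@(_ ∷ _)} {Z′@(_ ∷ _)} {e} {e′} refl refl eq =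
  e≡e′ , map-injective (insertAt-injective e inside) (Vecₚ.∷-injectiveʳ (subst (λ e″ → extend Z e ≡ extend Z′ e″) (sym e≡e′) eq))
  where
  singletons : ⁅ e ⁆ ≡ ⁅ e′ ⁆
  singletons = trans (sym (insertAt-⊥ e)) (trans (cong (λ M → lookup M (suc zero)) eq) (insertAt-⊥ e′))
  e≡e′ : e ≡ e′
  e≡e′ = x∈⁅y⁆⇒x≡y e′ (subst (e ∈ˢ_) singletons (x∈⁅x⁆ e))

chains-unique : ∀ n → Unique (chains n)
chains-unique zero    = [] ∷ []
chains-unique (suc n) = concatMap-unique (chains-unique n) extensions-unique extensions-disjoint
  where
  bottom : ∀ {Z} → Z ∈ chains n → lookup Z zero ≡ ⊥
  bottom Z∈ = proj₁ (All.lookup (chains-maximal n) Z∈)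
  extensions-unique : ∀ {Z} → Z ∈ chains n → Unique (map (extend Z) (allFin (suc n)))
  extensions-unique {Z} Z∈ =
    Uniqueₚ.map⁺ {f = extend Z} (λ eq → proj₁ (extend-injective (bottom Z∈) (bottom Z∈) eq)) (Uniqueₚ.allFin⁺ (suc n))
  extensions-disjoint : ∀ {Z Z′ M} → Z ∈ chains n → Z′ ∈ chains n →
                        M ∈ map (extend Z) (allFin (suc n)) → M ∈ map (extend Z′) (allFin (suc n)) → Z ≡ Z′
  extensions-disjoint {Z} {Z′} Z∈ Z′∈ M∈ M∈′ =
    let e , _ , M≡ = ∈-map⁻ (extend Z) {xs = allFin (suc n)} M∈
        e′ , _ , M≡′ = ∈-map⁻ (extend Z′) {xs = allFin (suc n)} M∈′
    in proj₂ (extend-injective {e = e} {e′} (bottom Z∈) (bottom Z′∈) (trans (sym M≡) M≡′))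

occurrences : ∀ {n} → Subset n → Chain n → ℕ
occurrences X Z = ∑[ Y ← toList Z ] 𝟙 (Y ≟ˢ X)

occurrences-extend : ∀ {n} X (Z : Chain n) e →
  occurrences X (extend Z e) ≡ 𝟙 (⊥ ≟ˢ X) + 𝟙 (lookup X e Bool.≟ inside) * occurrences (removeAt X e) Z
occurrences-extend X Z e = cong (𝟙 (⊥ ≟ˢ X) +_) (begin
  ∑[ Y ← toList (Vec.map f Z) ] 𝟙 (Y ≟ˢ X)     ≡⟨ cong (λ Ys → ∑[ Y ← Ys ] 𝟙 (Y ≟ˢ X)) (Vecₚ.toList-map f Z) ⟩
  ∑[ Y ← map f (toList Z) ] 𝟙 (Y ≟ˢ X)         ≡⟨ ∑-map f (toList Z) (λ Y → 𝟙 (Y ≟ˢ X)) ⟩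
  ∑[ Y ← toList Z ] 𝟙 (f Y ≟ˢ X)               ≡⟨ ∑-cong (toList Z) 𝟙-insertAt ⟩
  ∑[ Y ← toList Z ] (𝟙 X[e]? * 𝟙 (Y ≟ˢ removeAt X e)) ≡⟨ ∑-*ˡ (toList Z) (𝟙 X[e]?) (λ Y → 𝟙 (Y ≟ˢ removeAt X e)) ⟩
  𝟙 X[e]? * occurrences (removeAt X e) Z       ∎)
  where
  open ≡-Reasoning
  f : Subset _ → Subset _
  f Y = insertAt Y e inside
  X[e]? = lookup X e Bool.≟ inside
  𝟙-insertAt : ∀ Y → 𝟙 (f Y ≟ˢ X) ≡ 𝟙 X[e]? * 𝟙 (Y ≟ˢ removeAt X e)
  𝟙-insertAt Y = trans (𝟙-cong (insertAt≡⇔ Y X e inside) (f Y ≟ˢ X) (X[e]? ×-dec (Y ≟ˢ removeAt X e))) (𝟙-× X[e]? (Y ≟ˢ removeAt X e))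

chains-through-suc : ∀ n (X : Subset (suc n)) →
  ∑[ M ← chains (suc n) ] occurrences X M ≡
  suc n ! * 𝟙 (⊥ ≟ˢ X) + ∑[ e ← allFin (suc n) ] (𝟙 (lookup X e Bool.≟ inside) * ∑[ Z ← chains n ] occurrences (removeAt X e) Z)
chains-through-suc n X = begin
  ∑[ M ← chains (suc n) ] occurrences X M
    ≡⟨ ∑-chains-suc n (occurrences X) ⟩
  ∑[ Z ← Zs ] ∑[ e ← es ] occurrences X (extend Z e)
    ≡⟨ ∑-cong Zs (λ Z → ∑-cong es (occurrences-extend X Z)) ⟩
  ∑[ Z ← Zs ] ∑[ e ← es ] (⊥? + X[ e ]? * occurrences (removeAt X e) Z)
    ≡⟨ ∑-cong Zs (λ Z → ∑-+ es (λ _ → ⊥?) (λ e → X[ e ]? * occurrences (removeAt X e) Z)) ⟩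
  ∑[ Z ← Zs ] (∑[ e ← es ] ⊥? + ∑[ e ← es ] (X[ e ]? * occurrences (removeAt X e) Z))
    ≡⟨ ∑-+ Zs (λ _ → ∑[ e ← es ] ⊥?) (λ Z → ∑[ e ← es ] (X[ e ]? * occurrences (removeAt X e) Z)) ⟩
  ∑[ Z ← Zs ] ∑[ e ← es ] ⊥? + ∑[ Z ← Zs ] ∑[ e ← es ] (X[ e ]? * occurrences (removeAt X e) Z)
    ≡⟨ cong₂ _+_ constant (∑-swap Zs es (λ Z e → X[ e ]? * occurrences (removeAt X e) Z)) ⟩
  suc n ! * ⊥? + ∑[ e ← es ] ∑[ Z ← Zs ] (X[ e ]? * occurrences (removeAt X e) Z)
    ≡⟨ cong (suc n ! * ⊥? +_) (∑-cong es (λ e → ∑-*ˡ Zs X[ e ]? (occurrences (removeAt X e)))) ⟩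
  suc n ! * ⊥? + ∑[ e ← es ] (X[ e ]? * ∑[ Z ← Zs ] occurrences (removeAt X e) Z)
    ∎
  where
  open ≡-Reasoning
  Zs = chains n
  es = allFin (suc n)
  ⊥? = 𝟙 (⊥ ≟ˢ X)
  X[_]? : Fin (suc n) → ℕ
  X[ e ]? = 𝟙 (lookup X e Bool.≟ inside)
  constant : ∑[ Z ← Zs ] ∑[ e ← es ] ⊥? ≡ suc n ! * ⊥?
  constant = begin
    ∑[ Z ← Zs ] ∑[ e ← es ] ⊥?         ≡⟨ ∑-cong Zs (λ _ → trans (∑-const es ⊥?) (cong (_* ⊥?) (length-allFin (suc n)))) ⟩
    ∑[ Z ← Zs ] (suc n * ⊥?)           ≡⟨ ∑-const Zs (suc n * ⊥?) ⟩
    length Zs * (suc n * ⊥?)           ≡⟨ cong (_* (suc n * ⊥?)) (length-chains n) ⟩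
    n ! * (suc n * ⊥?)                 ≡⟨ solve 3 (λ f m b → f :* (m :* b) := (m :* f) :* b) refl (n !) (suc n) ⊥? ⟩
    suc n ! * ⊥?                       ∎

chains-through : ∀ n (X : Subset n) → ∑[ Z ← chains n ] occurrences X Z ≡ ∣ X ∣ ! * (n ∸ ∣ X ∣) !
chains-through zero    []    = refl
chains-through (suc n) X = begin
  ∑[ M ← chains (suc n) ] occurrences X M
    ≡⟨ chains-through-suc n X ⟩
  suc n ! * ⊥? + ∑[ e ← allFin (suc n) ] (X[ e ]? * ∑[ Z ← chains n ] occurrences (removeAt X e) Z)
    ≡⟨ cong (suc n ! * ⊥? +_) (∑-cong (allFin (suc n)) through-removeAt) ⟩
  suc n ! * ⊥? + ∑[ e ← allFin (suc n) ] (X[ e ]? * c)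
    ≡⟨ cong (suc n ! * ⊥? +_) (trans (∑-*ʳ (allFin (suc n)) c X[_]?) (cong (_* c) (sym (∣p∣≡∑-lookup X)))) ⟩
  suc n ! * ⊥? + ∣ X ∣ * c
    ≡⟨ close ∣ X ∣ refl ⟩
  ∣ X ∣ ! * (suc n ∸ ∣ X ∣) !
    ∎
  where
  open ≡-Reasoning
  ⊥? = 𝟙 (⊥ ≟ˢ X)
  X[_]? : Fin (suc n) → ℕ
  X[ e ]? = 𝟙 (lookup X e Bool.≟ inside)
  -- Only used multiplied by ∣ X ∣, so the junk value pred 0 = 0 is harmless.
  c = pred ∣ X ∣ ! * (n ∸ pred ∣ X ∣) !
  through-removeAt : ∀ e → X[ e ]? * ∑[ Z ← chains n ] occurrences (removeAt X e) Z ≡ X[ e ]? * c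
  through-removeAt e with lookup X e Bool.≟ inside
  ... | yes X[e] = cong (1 *_) (trans (chains-through n (removeAt X e)) (cong (λ s → s ! * (n ∸ s) !) (cong pred (∣removeAt∣ X e X[e]))))
  ... | no  _    = refl
  close : ∀ s → ∣ X ∣ ≡ s → suc n ! * ⊥? + s * (pred s ! * (n ∸ pred s) !) ≡ s ! * (suc n ∸ s) !
  close zero    ∣X∣≡0   = begin
    suc n ! * ⊥? + 0 ≡⟨ cong (λ b → suc n ! * b + 0) (𝟙-yes (sym (∣p∣≡0⇒p≡⊥ ∣X∣≡0)) (⊥ ≟ˢ X)) ⟩
    suc n ! * 1 + 0  ≡⟨ solve 1 (λ f → f :* con 1 :+ con 0 := con 1 :* f) refl (suc n !) ⟩
    1 * suc n !      ∎
  close (suc s) ∣X∣≡1+s = begin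
    suc n ! * ⊥? + suc s * (s ! * (n ∸ s) !) ≡⟨ cong (λ b → suc n ! * b + suc s * (s ! * (n ∸ s) !)) (𝟙-no ⊥≢X (⊥ ≟ˢ X)) ⟩
    suc n ! * 0 + suc s * (s ! * (n ∸ s) !)  ≡⟨ cong (_+ suc s * (s ! * (n ∸ s) !)) (*-zeroʳ (suc n !)) ⟩
    suc s * (s ! * (n ∸ s) !)                ≡⟨ *-assoc (suc s) (s !) ((n ∸ s) !) ⟨
    suc s ! * (n ∸ s) !                      ∎
    where
    ⊥≢X : ⊥ ≢ X
    ⊥≢X ⊥≡X = 0≢1+n (trans (sym (∣⊥∣≡0 (suc n))) (trans (cong ∣_∣ ⊥≡X) ∣X∣≡1+s))

bound-from-double-count : ∀ {b c f h m N p q} → (b * q + p) * c < q * f → f * h ≤ N + m * b → c * h ≡ m → p * m ≤ q * N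
bound-from-double-count {b} {c} {f} {h} {m} {N} {p} {q} excess double-count refl = +-cancelˡ-≤ (q * (m * b)) (p * m) (q * N) (begin
  q * (m * b) + p * m      ≡⟨ solve 5 (λ b c h p q → q :* ((c :* h) :* b) :+ p :* (c :* h) := ((b :* q :+ p) :* c) :* h) refl b c h p q ⟩
  ((b * q + p) * c) * h    ≤⟨ *-monoˡ-≤ h (<⇒≤ excess) ⟩
  (q * f) * h              ≡⟨ *-assoc q f h ⟩
  q * (f * h)              ≤⟨ *-monoʳ-≤ q double-count ⟩
  q * (N + m * b)          ≡⟨ solve 4 (λ q N m b → q :* (N :+ m :* b) := q :* (m :* b) :+ q :* N) refl q N m b ⟩
  q * (m * b) + q * N      ∎)
  where open ≤-Reasoning

module MarkedChains {n} (𝓕 : List (Subset n)) (d k : ℕ) where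
  open Markers {_≻_ = _⊃_ {n}} ∣_∣ p⊂q⇒∣p∣<∣q∣ d
  open DecMembership (_≟ˢ_ {n}) using (_∈?_)

  -- Largest set first, matching F₁ ⊋ F₂ ⊋ ⋯.
  onChain : Chain n → List (Subset n)
  onChain Z = reverse (filter (_∈? 𝓕) (toList Z))

  markedChains : Chain n → List (MarkedChainData n (suc k))
  markedChains Z = map (Z ,_) (markers (suc k) (onChain Z))

  allMarkedChains : List (MarkedChainData n (suc k))
  allMarkedChains = concatMap markedChains (chains n)

  onChain-descending : ∀ {Z} → AllPairs _⊂_ (toList Z) → Descending (onChain Z)
  onChain-descending strict = AllPairs-reverse⁺ (AllPairsₚ.filter⁺ (_∈? 𝓕) strict)

  ∈-onChain⁻ : ∀ Z {X} → X ∈ onChain Z → InChain X Z × X ∈ 𝓕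
  ∈-onChain⁻ Z X∈ with X∈Z , X∈𝓕 ← ∈-filter⁻ (_∈? 𝓕) {xs = toList Z} (Anyₚ.reverse⁻ X∈) = ∈-toList⇒InChain X∈Z , X∈𝓕

  markedChain-valid : ∀ {Z v} → IsMaximalChain n Z → MarkersIn (onChain Z) v → IsMarkedChainIn n (suc k) (suc d) 𝓕 (Z , v)
  markedChain-valid {Z} maximal (members , spaced) =
    maximal , proj₁ ∘ ∈-onChain⁻ Z ∘ members , separated , proj₂ ∘ ∈-onChain⁻ Z ∘ members
    where
    separated = λ i j j≡1+i → let Fj⊂Fi , gap = spaced i j j≡1+i in
      Fj⊂Fi , +-cancelʳ-≤ _ (suc d) _ (subst (suc d + _ ≤_) (sym (∣p─q∣+∣q∣≡∣p∣ (proj₁ Fj⊂Fi))) gap)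

  allMarkedChains-valid : All (IsMarkedChainIn n (suc k) (suc d) 𝓕) allMarkedChains
  allMarkedChains-valid = All-concatMap⁺ (All.tabulate λ {Z} Z∈ →
    Allₚ.map⁺ (All.map (λ {v} → markedChain-valid {Z} {v} (All.lookup (chains-maximal n) Z∈))
                       (markers-valid (suc k) (onChain Z) (onChain-descending (All.lookup (chains-strict n) Z∈)))))

  allMarkedChains-unique : Unique allMarkedChains
  allMarkedChains-unique = concatMap-unique (chains-unique n) markedChains-unique same-chain
    where
    markedChains-unique : ∀ {Z} → Z ∈ chains n → Unique (markedChains Z)
    markedChains-unique {Z} Z∈ = Uniqueₚ.map⁺ (cong proj₂) (markers-unique k (onChain Z) (onChain-descending (All.lookup (chains-strict n) Z∈)))
    chain-of : ∀ {Z F} → F ∈ markedChains Z → proj₁ F ≡ Z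
    chain-of {Z} F∈ with _ , _ , refl ← ∈-map⁻ (Z ,_) F∈ = refl
    same-chain : ∀ {Z Z′ F} → Z ∈ chains n → Z′ ∈ chains n → F ∈ markedChains Z → F ∈ markedChains Z′ → Z ≡ Z′
    same-chain _ _ F∈ F∈′ = trans (sym (chain-of F∈)) (chain-of F∈′)

  occurrences≡length-onChain : Unique 𝓕 → ∀ Z → ∑[ X ← 𝓕 ] occurrences X Z ≡ length (onChain Z)
  occurrences≡length-onChain uniq Z = begin
    ∑[ X ← 𝓕 ] ∑[ Y ← toList Z ] 𝟙 (Y ≟ˢ X)   ≡⟨ ∑-swap 𝓕 (toList Z) (λ X Y → 𝟙 (Y ≟ˢ X)) ⟩
    ∑[ Y ← toList Z ] ∑[ X ← 𝓕 ] 𝟙 (Y ≟ˢ X)   ≡⟨ ∑-cong (toList Z) (λ Y → ∑𝟙≟-unique _≟ˢ_ Y uniq) ⟩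
    ∑[ Y ← toList Z ] 𝟙 (Y ∈? 𝓕)              ≡⟨ length-filter (_∈? 𝓕) (toList Z) ⟨
    length (filter (_∈? 𝓕) (toList Z))        ≡⟨ Listₚ.length-reverse (filter (_∈? 𝓕) (toList Z)) ⟨
    length (onChain Z)                        ∎
    where open ≡-Reasoning

  length-allMarkedChains : Unique 𝓕 → length 𝓕 * midFactorials n ≤ length allMarkedChains + n ! * (k * suc d)
  length-allMarkedChains uniq = begin
    length 𝓕 * midFactorials n                         ≡⟨ ∑-const 𝓕 (midFactorials n) ⟨
    ∑[ X ← 𝓕 ] midFactorials n                         ≤⟨ ∑-mono 𝓕 (λ X → midFactorials-minimal (∣p∣≤n X)) ⟩
    ∑[ X ← 𝓕 ] (∣ X ∣ ! * (n ∸ ∣ X ∣) !)               ≡⟨ ∑-cong 𝓕 (chains-through n) ⟨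
    ∑[ X ← 𝓕 ] ∑[ Z ← chains n ] occurrences X Z       ≡⟨ ∑-swap 𝓕 (chains n) occurrences ⟩
    ∑[ Z ← chains n ] ∑[ X ← 𝓕 ] occurrences X Z       ≡⟨ ∑-cong (chains n) (occurrences≡length-onChain uniq) ⟩
    ∑[ Z ← chains n ] length (onChain Z)               ≤⟨ ∑-mono (chains n) length-markedChains ⟩
    ∑[ Z ← chains n ] (length (markedChains Z) + k * suc d)
      ≡⟨ ∑-+ (chains n) (length ∘ markedChains) (λ _ → k * suc d) ⟩
    ∑[ Z ← chains n ] length (markedChains Z) + ∑[ Z ← chains n ] (k * suc d)
      ≡⟨ cong₂ _+_ (length-concatMap markedChains (chains n))
                   (sym (trans (∑-const (chains n) (k * suc d)) (cong (_* (k * suc d)) (length-chains n)))) ⟨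
    length allMarkedChains + n ! * (k * suc d)         ∎
    where
    open ≤-Reasoning
    length-markedChains : ∀ Z → length (onChain Z) ≤ length (markedChains Z) + k * suc d
    length-markedChains Z = subst (λ m → length (onChain Z) ≤ m + k * suc d) (sym (Listₚ.length-map (Z ,_) (markers (suc k) (onChain Z))))
                              (length-markers k (onChain Z))

lemma2p9 : (n k a p q : ℕ) → 1 ≤ k → 1 ≤ a → 1 ≤ p → 1 ≤ q →
    (𝓕 : List (Subset n)) → Unique 𝓕 →
    ((k ∸ 1) * a * q + p) * (n C ⌊ n /2⌋) < q * length 𝓕 →
    Σ ℕ λ N → (p * (n !) ≤ k * q * N) × AtLeast N (IsMarkedChainIn n k a 𝓕)
lemma2p9 n (suc k) (suc d) p q (s≤s z≤n) (s≤s z≤n) _ _ 𝓕 uniq excess =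
  N , p*n!≤k*q*N , atLeast-length allMarkedChains-unique allMarkedChains-valid
  where
  open MarkedChains 𝓕 d k
  N = length allMarkedChains
  p*n!≤q*N : p * n ! ≤ q * N
  p*n!≤q*N = bound-from-double-count excess (length-allMarkedChains uniq) (nCk*k![n∸k]!≡n! (⌊n/2⌋≤n n))
  p*n!≤k*q*N : p * n ! ≤ suc k * q * N
  p*n!≤k*q*N = ≤-trans p*n!≤q*N (subst (q * N ≤_) (sym (*-assoc (suc k) q N)) (m≤n*m (q * N) (suc k)))
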